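{- Let $U\subseteq\mathbb Z$, $f:U\to\mathbb Z$, and let $X=\{x_1,\dots,x_n\}\subseteq U$ be a circuit for $f$. Let $2\leq m\leq n$ and let $e\in\langle x_1,\dots,x_m\rangle$ with $e\in U\setminus X$. Then there is at least one $i\in\{1,\dots,m\}$ such that $f_{(X\cup\{e\})\setminus\{x_i\}}\notin\mathbb Z[x]$.
   Context: For a finite set $Y\subseteq\mathbb Z$ and a function $f$ defined on $Y$, $f_Y\in\mathbb Q[x]$ denotes the interpolation polynomial of $f$ on $Y$, i.e. the unique polynomial of degree at most $|Y|-1$ agreeing with $f$ on $Y$. A finite set $X$ in the domain of $f$ is a circuit for $f$ if $f_X\notin\mathbb Z[x]$ but $f_{X\setminus\{a\}}\in\mathbb Z[x]$ for every $a\in X$. An arithmetic progression in $\mathbb N$ is full if it is of the form $(a+d\mathbb Z)\cap\mathbb N$; for a set $Y$ of integers, $\langle x_1,\dots,x_m\rangle$ denotes the arithmetic convex closure of $\{x_1,\dots,x_m\}$: the intersection of all full arithmetic progressions containing it (for $m\ge2$ distinct elements this is the full progression through $x_1$ with common difference $\gcd_{i,k}(x_i-x_k)$). -}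

module Defs where

open import Data.Nat using (ℕ; _≤_)
open import Data.Integer using (ℤ; _+_; _*_; _-_; 0ℤ)
open import Data.Integer.Divisibility using (_∣_)
open import Data.List using (List; []; _∷_; length; filter)
open import Data.List.Relation.Unary.All using (All)
open import Data.List.Membership.Propositional using (_∈_)
open import Data.Product using (Σ; _×_)
open import Relation.Nullary using (¬_; ¬?)
open import Relation.Binary.PropositionalEquality using (_≡_)
import Data.Integer.Properties as ℤP

-- Polynomials with integer coefficients, as coefficient lists (constant term first).
ℤPoly : Set
ℤPoly = List ℤ

eval : ℤPoly → ℤ → ℤ
eval []      y = 0ℤ
eval (c ∷ p) y = c + y * eval p y

-- "f_Y ∈ ℤ[x]" for a finite set Y ⊆ ℤ of distinct elements (given as a list):
-- the interpolation polynomial f_Y (the unique polynomial of degree ≤ |Y|-1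
-- agreeing with f on Y) has integer coefficients, i.e. there is an integer
-- polynomial of degree ≤ |Y|-1 (at most |Y| coefficients) agreeing with f on Y.
InterpInZ : (ℤ → ℤ) → List ℤ → Set
InterpInZ f Y = Σ ℤPoly λ p → (length p ≤ length Y) × All (λ y → eval p y ≡ f y) Y

remove : ℤ → List ℤ → List ℤ
remove a Y = filter (λ y → ¬? (y ℤP.≟ a)) Y

Circuit : (ℤ → ℤ) → List ℤ → Set
Circuit f X = (¬ InterpInZ f X) × (∀ {a} → a ∈ X → InterpInZ f (remove a X))

-- e lies in the arithmetic convex closure of S: e belongs to every full
-- arithmetic progression a + dℤ (a, d ∈ ℤ) containing S.
InConvClosure : ℤ → List ℤ → Set
InConvClosure e S = ∀ (a d : ℤ) → All (λ s → d ∣ (s - a)) S → d ∣ (e - a)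

{-# OPTIONS --safe #-}
module Submission where

-- Suppose f had an integral interpolant p_s on (X ∪ {e}) ∖ {s} for every s ∈ S = {x₁,…,x_m}. Fix a ∈ S
-- and put B = ∏_{y ∈ X∖{a}} (a − y), δ = p_a(a) − f(a). For s ∈ S, p_a − p_s has degree < |X| and
-- vanishes on the |X| − 1 points (X ∪ {e}) ∖ {a, s}, so integer synthetic division makes it an integral
-- multiple of ∏ (x − y) over these points; evaluating at a gives B (e − a) ∣ δ (s − a). The t with
-- B (e − a) ∣ δ (t − a) form a full progression through a; it contains S, hence e, and cancelling
-- e − a ≠ 0 leaves B ∣ δ. Then p_a − (δ / B) ∏_{y ∈ X∖{a}} (x − y) is an integral interpolant on X,
-- contradicting that X is a circuit. The same factor argument shows that, given an integral interpolant
-- q on L, integrality on L ∪ {z} is the decidable condition ∏_{y ∈ L} (z − y) ∣ f(z) − q(z); this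
-- turns the contradiction into an explicit index i.

open import Defs
open import Data.Nat as ℕ using (ℕ; _≤_; suc; s≤s)
import Data.Nat.Properties as ℕP
import Data.Nat.Divisibility as ℕD
open import Data.Nat.GCD using (gcd; gcd[m,n]∣m; gcd[m,n]∣n; gcd[m,n]≢0)
open import Data.Nat.DivMod using (_/_; m/n*n≡m)
open import Data.Nat.Coprimality using (coprime-/gcd; coprime-divisor)
open import Data.Integer as ℤ using (ℤ; NonZero; _+_; _*_; _-_; -_; 0ℤ; 1ℤ; ∣_∣; ≢-nonZero)
open import Data.Integer.Properties
open import Data.Integer.Tactic.RingSolver using (solve-∀)
import Data.Integer.Divisibility as U
open import Data.Integer.Divisibility.Signed using (divides; ∣ᵤ⇒∣; ∣⇒∣ᵤ; _∣?_) renaming (_∣_ to _∣ₛ_)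
open import Data.Fin using (Fin; inject≤)
import Data.Fin as Fin
import Data.Fin.Properties as FinP
open import Data.List using (List; []; _∷_; length; map; tabulate)
open import Data.List.Properties using (length-map; filter-all)
open import Data.List.Relation.Unary.All as All using (All; _∷_)
open import Data.List.Relation.Unary.All.Properties using (tabulate⁺)
open import Data.List.Relation.Unary.Any using (here; there)
open import Data.List.Membership.Propositional using (_∈_; _∉_)
open import Data.List.Membership.Propositional.Properties using (∈-tabulate⁺; ∈-tabulate⁻; ∈-filter⁺; ∈-filter⁻)
open import Data.List.Relation.Binary.Subset.Propositional using (_⊆_)
open import Data.List.Relation.Unary.Unique.Propositional using (Unique; _∷_)
import Data.List.Relation.Unary.Unique.Propositional.Properties as Unique
open import Data.Product using (Σ; ∃-syntax; _,_; proj₁; proj₂; _×_)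
open import Data.Sum using (inj₁; inj₂)
open import Data.Empty using (⊥-elim)
open import Function.Base using (_∘_)
open import Function.Bundles using (_⇔_; mk⇔; module Equivalence)
open import Function.Definitions using (Injective)
open import Relation.Nullary using (¬_; ¬?; Dec; yes; no)
import Relation.Nullary.Decidable as Dec
open import Relation.Binary.PropositionalEquality

infixl 6 _+ₚ_ _-ₚ_
infixr 7 _·ₚ_

_+ₚ_ : ℤPoly → ℤPoly → ℤPoly
[]      +ₚ q       = q
(a ∷ p) +ₚ []      = a ∷ p
(a ∷ p) +ₚ (b ∷ q) = a + b ∷ p +ₚ q

_·ₚ_ : ℤ → ℤPoly → ℤPoly
c ·ₚ p = map (c *_) p

_-ₚ_ : ℤPoly → ℤPoly → ℤPoly
p -ₚ q = p +ₚ (- 1ℤ) ·ₚ q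

eval-+ₚ : ∀ p q y → eval (p +ₚ q) y ≡ eval p y + eval q y
eval-+ₚ []      q       y = sym (+-identityˡ _)
eval-+ₚ (a ∷ p) []      y = sym (+-identityʳ _)
eval-+ₚ (a ∷ p) (b ∷ q) y = begin
  a + b + y * eval (p +ₚ q) y           ≡⟨ cong (λ t → a + b + y * t) (eval-+ₚ p q y) ⟩
  a + b + y * (eval p y + eval q y)     ≡⟨ regroup a b y (eval p y) (eval q y) ⟩
  a + y * eval p y + (b + y * eval q y) ∎
  where
  open ≡-Reasoning
  regroup : ∀ a b y u v → a + b + y * (u + v) ≡ a + y * u + (b + y * v)
  regroup = solve-∀

eval-·ₚ : ∀ c p y → eval (c ·ₚ p) y ≡ c * eval p y
eval-·ₚ c []      y = sym (*-zeroʳ c)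
eval-·ₚ c (a ∷ p) y = begin
  c * a + y * eval (c ·ₚ p) y ≡⟨ cong (λ t → c * a + y * t) (eval-·ₚ c p y) ⟩
  c * a + y * (c * eval p y)  ≡⟨ regroup c a y (eval p y) ⟩
  c * (a + y * eval p y)      ∎
  where
  open ≡-Reasoning
  regroup : ∀ c a y u → c * a + y * (c * u) ≡ c * (a + y * u)
  regroup = solve-∀

eval--ₚ : ∀ p q y → eval (p -ₚ q) y ≡ eval p y - eval q y
eval--ₚ p q y = begin
  eval (p +ₚ (- 1ℤ) ·ₚ q) y       ≡⟨ eval-+ₚ p _ y ⟩
  eval p y + eval ((- 1ℤ) ·ₚ q) y ≡⟨ cong (eval p y +_) (eval-·ₚ (- 1ℤ) q y) ⟩
  eval p y + (- 1ℤ) * eval q y    ≡⟨ regroup (eval p y) (eval q y) ⟩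
  eval p y - eval q y             ∎
  where
  open ≡-Reasoning
  regroup : ∀ u v → u + (- 1ℤ) * v ≡ u - v
  regroup = solve-∀

length-+ₚ : ∀ {k} p q → length p ≤ k → length q ≤ k → length (p +ₚ q) ≤ k
length-+ₚ []      q       _         q≤k       = q≤k
length-+ₚ (a ∷ p) []      p≤k       _         = p≤k
length-+ₚ (a ∷ p) (b ∷ q) (s≤s p≤k) (s≤s q≤k) = s≤s (length-+ₚ p q p≤k q≤k)

length-·ₚ : ∀ c p → length (c ·ₚ p) ≡ length p
length-·ₚ c = length-map (c *_)

length-+ₚ-·ₚ : ∀ {k} p c q → length p ≤ k → length q ≤ k → length (p +ₚ c ·ₚ q) ≤ k
length-+ₚ-·ₚ {k} p c q p≤k q≤k =
  length-+ₚ p (c ·ₚ q) p≤k (subst (_≤ k) (sym (length-·ₚ c q)) q≤k)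

nodeProd : List ℤ → ℤ → ℤ
nodeProd []      y = 1ℤ
nodeProd (z ∷ L) y = (y - z) * nodeProd L y

nodePoly : List ℤ → ℤPoly
nodePoly []      = 1ℤ ∷ []
nodePoly (z ∷ L) = (0ℤ ∷ nodePoly L) -ₚ z ·ₚ nodePoly L

eval-nodePoly : ∀ L y → eval (nodePoly L) y ≡ nodeProd L y
eval-nodePoly []      y = cong (1ℤ +_) (*-zeroʳ y)
eval-nodePoly (z ∷ L) y = begin
  eval ((0ℤ ∷ p) -ₚ z ·ₚ p) y                  ≡⟨ eval--ₚ (0ℤ ∷ p) (z ·ₚ p) y ⟩
  0ℤ + y * eval p y - eval (z ·ₚ p) y          ≡⟨ cong (_-_ (0ℤ + y * eval p y)) (eval-·ₚ z p y) ⟩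
  0ℤ + y * eval p y - z * eval p y             ≡⟨ regroup y z (eval p y) ⟩
  (y - z) * eval p y                           ≡⟨ cong ((y - z) *_) (eval-nodePoly L y) ⟩
  (y - z) * nodeProd L y                       ∎
  where
  open ≡-Reasoning
  p : ℤPoly
  p = nodePoly L
  regroup : ∀ y z u → 0ℤ + y * u - z * u ≡ (y - z) * u
  regroup = solve-∀

length-nodePoly : ∀ L → length (nodePoly L) ≤ suc (length L)
length-nodePoly []      = ℕP.≤-refl
length-nodePoly (z ∷ L) =
  length-+ₚ-·ₚ (0ℤ ∷ nodePoly L) (- 1ℤ) (z ·ₚ nodePoly L) (s≤s (length-nodePoly L))
    (subst (_≤ suc (suc (length L))) (sym (length-·ₚ z (nodePoly L))) (ℕP.m≤n⇒m≤1+n (length-nodePoly L)))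

nodeProd-∈ : ∀ {z L} → z ∈ L → nodeProd L z ≡ 0ℤ
nodeProd-∈ {z} {_ ∷ L} (here refl) = trans (cong (_* nodeProd L z) (+-inverseʳ z)) (*-zeroˡ (nodeProd L z))
nodeProd-∈ {z} {w ∷ L} (there z∈L) = trans (cong ((z - w) *_) (nodeProd-∈ z∈L)) (*-zeroʳ (z - w))

-- Synthetic division: tailValues z p is the quotient of c ∷ p by x − z, whatever the constant c.
tailValues : ℤ → ℤPoly → ℤPoly
tailValues z []      = []
tailValues z (d ∷ r) = eval (d ∷ r) z ∷ tailValues z r

length-tailValues : ∀ z p → length (tailValues z p) ≡ length p
length-tailValues z []      = refl
length-tailValues z (d ∷ r) = cong suc (length-tailValues z r)

remainder-theorem : ∀ c p z y → eval (c ∷ p) y ≡ eval (c ∷ p) z + (y - z) * eval (tailValues z p) y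
remainder-theorem c []      z y = regroup c y z
  where
  regroup : ∀ c y z → c + y * 0ℤ ≡ c + z * 0ℤ + (y - z) * 0ℤ
  regroup = solve-∀
remainder-theorem c (d ∷ r) z y = begin
  c + y * eval (d ∷ r) y
    ≡⟨ cong (λ t → c + y * t) (remainder-theorem d r z y) ⟩
  c + y * (eval (d ∷ r) z + (y - z) * eval (tailValues z r) y)
    ≡⟨ regroup c y z (eval (d ∷ r) z) (eval (tailValues z r) y) ⟩
  c + z * eval (d ∷ r) z + (y - z) * (eval (d ∷ r) z + y * eval (tailValues z r) y) ∎
  where
  open ≡-Reasoning
  regroup : ∀ c y z u v → c + y * (u + (y - z) * v) ≡ c + z * u + (y - z) * (u + y * v)
  regroup = solve-∀

tailValues-root : ∀ c p {z w} → eval (c ∷ p) z ≡ 0ℤ → z ≢ w → eval (c ∷ p) w ≡ 0ℤ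
                → eval (tailValues z p) w ≡ 0ℤ
tailValues-root c p {z} {w} pz≡0 z≢w pw≡0 with i*j≡0⇒i≡0∨j≡0 (w - z) product≡0
  where
  open ≡-Reasoning
  product≡0 : (w - z) * eval (tailValues z p) w ≡ 0ℤ
  product≡0 = begin
    (w - z) * eval (tailValues z p) w                  ≡⟨ +-identityˡ _ ⟨
    0ℤ + (w - z) * eval (tailValues z p) w             ≡⟨ cong (_+ (w - z) * eval (tailValues z p) w) pz≡0 ⟨
    eval (c ∷ p) z + (w - z) * eval (tailValues z p) w ≡⟨ remainder-theorem c p z w ⟨
    eval (c ∷ p) w                                     ≡⟨ pw≡0 ⟩
    0ℤ                                                 ∎
... | inj₁ w-z≡0 = ⊥-elim (z≢w (sym (i-j≡0⇒i≡j w z w-z≡0)))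
... | inj₂ q≡0   = q≡0

factor-theorem : ∀ L → Unique L → (p : ℤPoly) → length p ≤ suc (length L)
               → All (λ z → eval p z ≡ 0ℤ) L → ∃[ k ] ∀ y → eval p y ≡ k * nodeProd L y
factor-theorem _       _ []          _        _ = 0ℤ , λ _ → refl
factor-theorem []      _ (c ∷ [])    _        _ = c , λ y → begin
  c + y * 0ℤ ≡⟨ cong (c +_) (*-zeroʳ y) ⟩
  c + 0ℤ     ≡⟨ +-identityʳ c ⟩
  c          ≡⟨ *-identityʳ c ⟨
  c * 1ℤ     ∎
  where open ≡-Reasoning
factor-theorem []      _ (_ ∷ _ ∷ _) (s≤s ()) _
factor-theorem (z ∷ L) (z∉L ∷ L!) (c ∷ p) (s≤s p≤) (pz≡0 ∷ pL≡0)
  with k , q≡kW ← factor-theorem L L! (tailValues z p)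
                    (subst (_≤ suc (length L)) (sym (length-tailValues z p)) p≤)
                    (All.zipWith (λ (z≢w , pw≡0) → tailValues-root c p pz≡0 z≢w pw≡0) (z∉L , pL≡0))
  = k , λ y → begin
  eval (c ∷ p) y                                     ≡⟨ remainder-theorem c p z y ⟩
  eval (c ∷ p) z + (y - z) * eval (tailValues z p) y ≡⟨ cong₂ (λ s t → s + (y - z) * t) pz≡0 (q≡kW y) ⟩
  0ℤ + (y - z) * (k * nodeProd L y)                  ≡⟨ regroup y z k (nodeProd L y) ⟩
  k * ((y - z) * nodeProd L y)                       ∎
  where
  open ≡-Reasoning
  regroup : ∀ y z k u → 0ℤ + (y - z) * (k * u) ≡ k * ((y - z) * u)
  regroup = solve-∀

∈-remove⁺ : ∀ {a w X} → w ∈ X → w ≢ a → w ∈ remove a X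
∈-remove⁺ {a} = ∈-filter⁺ (λ y → ¬? (y ≟ a))

∈-remove⁻ : ∀ {a w} X → w ∈ remove a X → w ∈ X × w ≢ a
∈-remove⁻ {a} X = ∈-filter⁻ (λ y → ¬? (y ≟ a)) {xs = X}

remove-Unique : ∀ {a X} → Unique X → Unique (remove a X)
remove-Unique {a} = Unique.filter⁺ (λ y → ¬? (y ≟ a))

remove-∉ : ∀ {a X} → All (a ≢_) X → remove a X ≡ X
remove-∉ {a} a∉X = filter-all (λ y → ¬? (y ≟ a)) (All.map (_∘ sym) a∉X)

⊆-∷-remove : ∀ {a X} → X ⊆ a ∷ remove a X
⊆-∷-remove {a} {X} {w} w∈X with w ≟ a
... | yes refl = here refl
... | no w≢a   = there (∈-remove⁺ w∈X w≢a)

length-remove : ∀ {a X} → Unique X → a ∈ X → suc (length (remove a X)) ≡ length X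
length-remove {a} {a ∷ X} (a∉X ∷ _) (here refl) with a ≟ a
... | yes _   = cong (suc ∘ length) (remove-∉ a∉X)
... | no a≢a  = ⊥-elim (a≢a refl)
length-remove {a} {w ∷ X} (w∉X ∷ X!) (there a∈X) with w ≟ a
... | yes refl = ⊥-elim (All.lookup w∉X a∈X refl)
... | no _     = cong suc (length-remove X! a∈X)

nodeProd-remove : ∀ {a X} → Unique X → a ∈ X → ∀ y → nodeProd X y ≡ (y - a) * nodeProd (remove a X) y
nodeProd-remove {a} {a ∷ X} (a∉X ∷ _) (here refl) y with a ≟ a
... | yes _  = cong (λ L → (y - a) * nodeProd L y) (sym (remove-∉ a∉X))
... | no a≢a = ⊥-elim (a≢a refl)
nodeProd-remove {a} {w ∷ X} (w∉X ∷ X!) (there a∈X) y with w ≟ a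
... | yes refl = ⊥-elim (All.lookup w∉X a∈X refl)
... | no _     = begin
  (y - w) * nodeProd X y                         ≡⟨ cong ((y - w) *_) (nodeProd-remove X! a∈X y) ⟩
  (y - w) * ((y - a) * nodeProd (remove a X) y)  ≡⟨ *-assoc (y - w) (y - a) _ ⟨
  (y - w) * (y - a) * nodeProd (remove a X) y    ≡⟨ cong (_* nodeProd (remove a X) y) (*-comm (y - w) (y - a)) ⟩
  (y - a) * (y - w) * nodeProd (remove a X) y    ≡⟨ *-assoc (y - a) (y - w) _ ⟩
  (y - a) * ((y - w) * nodeProd (remove a X) y)  ∎
  where open ≡-Reasoning

Agrees : (ℤ → ℤ) → ℤPoly → List ℤ → Set
Agrees f p = All (λ y → eval p y ≡ f y)

root--ₚ : ∀ p q {w v} → eval p w ≡ v → eval q w ≡ v → eval (p -ₚ q) w ≡ 0ℤ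
root--ₚ p q {w} {v} pw≡v qw≡v = begin
  eval (p -ₚ q) w     ≡⟨ eval--ₚ p q w ⟩
  eval p w - eval q w ≡⟨ cong₂ _-_ pw≡v qw≡v ⟩
  v - v               ≡⟨ +-inverseʳ v ⟩
  0ℤ                  ∎
  where open ≡-Reasoning

InterpInZ-⊇ : ∀ f {Y Y′} → Y ⊆ Y′ → length Y′ ≤ length Y → InterpInZ f Y′ → InterpInZ f Y
InterpInZ-⊇ f Y⊆Y′ Y′≤Y (p , p≤Y′ , p≈f) =
  p , ℕP.≤-trans p≤Y′ Y′≤Y , All.tabulate (All.lookup p≈f ∘ Y⊆Y′)

module _ (f : ℤ → ℤ) {L : List ℤ} (q : ℤPoly) (q≤ : length q ≤ suc (length L)) (q≈f : Agrees f q L)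
         (z : ℤ) where

  InterpInZ-∷⇒∣ : Unique L → InterpInZ f (z ∷ L) → nodeProd L z ∣ₛ f z - eval q z
  InterpInZ-∷⇒∣ L! (p , p≤ , pz≡fz ∷ p≈f) with factor-theorem L L! (p -ₚ q) p-q≤ p-q-roots
    where
    p-q≤ : length (p -ₚ q) ≤ suc (length L)
    p-q≤ = length-+ₚ-·ₚ p (- 1ℤ) q p≤ q≤
    p-q-roots : All (λ y → eval (p -ₚ q) y ≡ 0ℤ) L
    p-q-roots = All.zipWith (λ (py≡fy , qy≡fy) → root--ₚ p q py≡fy qy≡fy) (p≈f , q≈f)
  ... | k , p-q≡kW = divides k (begin
    f z - eval q z      ≡⟨ cong (_- eval q z) pz≡fz ⟨
    eval p z - eval q z ≡⟨ eval--ₚ p q z ⟨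
    eval (p -ₚ q) z     ≡⟨ p-q≡kW z ⟩
    k * nodeProd L z    ∎)
    where open ≡-Reasoning

  ∣⇒InterpInZ-∷ : nodeProd L z ∣ₛ f z - eval q z → InterpInZ f (z ∷ L)
  ∣⇒InterpInZ-∷ (divides k fz-qz≡kW) =
    p , length-+ₚ-·ₚ q k (nodePoly L) q≤ (length-nodePoly L) , pz≡fz ∷ All.tabulate p≈f
    where
    open ≡-Reasoning
    p : ℤPoly
    p = q +ₚ k ·ₚ nodePoly L
    eval-p : ∀ y → eval p y ≡ eval q y + k * nodeProd L y
    eval-p y = begin
      eval p y                              ≡⟨ eval-+ₚ q _ y ⟩
      eval q y + eval (k ·ₚ nodePoly L) y   ≡⟨ cong (eval q y +_) (eval-·ₚ k (nodePoly L) y) ⟩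
      eval q y + k * eval (nodePoly L) y    ≡⟨ cong (λ t → eval q y + k * t) (eval-nodePoly L y) ⟩
      eval q y + k * nodeProd L y           ∎
    pz≡fz : eval p z ≡ f z
    pz≡fz = begin
      eval p z                     ≡⟨ eval-p z ⟩
      eval q z + k * nodeProd L z  ≡⟨ cong (eval q z +_) fz-qz≡kW ⟨
      eval q z + (f z - eval q z)  ≡⟨ cancel (eval q z) (f z) ⟩
      f z                          ∎
      where
      cancel : ∀ u v → u + (v - u) ≡ v
      cancel = solve-∀
    p≈f : ∀ {y} → y ∈ L → eval p y ≡ f y
    p≈f {y} y∈L = begin
      eval p y                     ≡⟨ eval-p y ⟩
      eval q y + k * nodeProd L y  ≡⟨ cong (λ t → eval q y + k * t) (nodeProd-∈ y∈L) ⟩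
      eval q y + k * 0ℤ            ≡⟨ cong (eval q y +_) (*-zeroʳ k) ⟩
      eval q y + 0ℤ                ≡⟨ +-identityʳ _ ⟩
      eval q y                     ≡⟨ All.lookup q≈f y∈L ⟩
      f y                          ∎

  InterpInZ-∷? : Unique L → Dec (InterpInZ f (z ∷ L))
  InterpInZ-∷? L! = Dec.map′ ∣⇒InterpInZ-∷ (InterpInZ-∷⇒∣ L!) (nodeProd L z ∣? f z - eval q z)

m∣n*o⇔m/gcd[m,n]∣o : ∀ m n o .{{_ : ℕ.NonZero (gcd m n)}} → m ℕD.∣ n ℕ.* o ⇔ m / gcd m n ℕD.∣ o
m∣n*o⇔m/gcd[m,n]∣o m n o = mk⇔ to from
  where
  open ≡-Reasoning
  g : ℕ
  g = gcd m n
  m′g≡m : m / g ℕ.* g ≡ m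
  m′g≡m = m/n*n≡m (gcd[m,n]∣m m n)
  n′og≡no : n / g ℕ.* o ℕ.* g ≡ n ℕ.* o
  n′og≡no = begin
    n / g ℕ.* o ℕ.* g   ≡⟨ ℕP.*-assoc (n / g) o g ⟩
    n / g ℕ.* (o ℕ.* g) ≡⟨ cong (n / g ℕ.*_) (ℕP.*-comm o g) ⟩
    n / g ℕ.* (g ℕ.* o) ≡⟨ ℕP.*-assoc (n / g) g o ⟨
    n / g ℕ.* g ℕ.* o   ≡⟨ cong (ℕ._* o) (m/n*n≡m (gcd[m,n]∣n m n)) ⟩
    n ℕ.* o             ∎
  to : m ℕD.∣ n ℕ.* o → m / g ℕD.∣ o
  to m∣no = coprime-divisor (coprime-/gcd m n)
              (ℕD.*-cancelʳ-∣ g (subst₂ ℕD._∣_ (sym m′g≡m) (sym n′og≡no) m∣no))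
  from : m / g ℕD.∣ o → m ℕD.∣ n ℕ.* o
  from m′∣o = subst₂ ℕD._∣_ m′g≡m n′og≡no (ℕD.*-monoˡ-∣ g (ℕD.∣n⇒∣m*n (n / g) m′∣o))

-- The s with u ∣ c * (s - a) form the full progression a + dℤ with d = ∣u∣ / gcd ∣u∣ ∣c∣.
InConvClosure-∣* : ∀ e S → InConvClosure e S
                 → ∀ u c a → All (λ s → u U.∣ c * (s - a)) S → u U.∣ c * (e - a)
InConvClosure-∣* e S e∈⟨S⟩ u c a u∣c[S-a] with c ≟ 0ℤ
... | yes refl = ℕD._∣0 ∣ u ∣
... | no c≢0   = Equivalence.from (u∣c*⇔d∣ (e - a))
                   (e∈⟨S⟩ a (ℤ.+ d) (All.map (Equivalence.to (u∣c*⇔d∣ _)) u∣c[S-a]))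
  where
  instance
    gcd≢0 : ℕ.NonZero (gcd ∣ u ∣ ∣ c ∣)
    gcd≢0 = ℕ.≢-nonZero (gcd[m,n]≢0 ∣ u ∣ ∣ c ∣ (inj₂ (c≢0 ∘ ∣i∣≡0⇒i≡0)))
  d : ℕ
  d = ∣ u ∣ / gcd ∣ u ∣ ∣ c ∣
  u∣c*⇔d∣ : ∀ s → u U.∣ c * s ⇔ ℤ.+ d U.∣ s
  u∣c*⇔d∣ s = subst (λ t → (∣ u ∣ ℕD.∣ t) ⇔ (d ℕD.∣ ∣ s ∣)) (sym (abs-* c s))
                (m∣n*o⇔m/gcd[m,n]∣o (∣ u ∣) (∣ c ∣) (∣ s ∣))

module _ (f : ℤ → ℤ) {X : List ℤ} (X! : Unique X) {e : ℤ} (e∉X : e ∉ X) where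

  exchange-∣ : ∀ {a b} → a ∈ X → b ∈ X
             → (P : InterpInZ f (e ∷ remove a X)) → InterpInZ f (e ∷ remove b X)
             → nodeProd (remove a X) a * (e - a) ∣ₛ (eval (proj₁ P) a - f a) * (b - a)
  exchange-∣ {a} {b} a∈X b∈X (p , p≤ , pe≡fe ∷ p≈f) (q , q≤ , qe≡fe ∷ q≈f) with b ≟ a
  ... | yes refl = divides 0ℤ (trans (cong ((eval p a - f a) *_) (+-inverseʳ a)) (*-zeroʳ (eval p a - f a)))
  ... | no b≢a   = divides h (begin
    (eval p a - f a) * (b - a)   ≡⟨ cong (_* (b - a)) pa-fa≡hW ⟩
    h * ((a - e) * C) * (b - a)  ≡⟨ regroup h a b e C ⟩
    h * ((a - b) * C * (e - a))  ≡⟨ cong (λ t → h * (t * (e - a))) (nodeProd-remove L! b∈L a) ⟨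
    h * (nodeProd L a * (e - a)) ∎)
    where
    open ≡-Reasoning
    L R M : List ℤ
    L = remove a X
    R = remove b L
    M = e ∷ R
    L! : Unique L
    L! = remove-Unique X!
    b∈L : b ∈ L
    b∈L = ∈-remove⁺ b∈X b≢a
    R⊆X : R ⊆ X
    R⊆X w∈R = proj₁ (∈-remove⁻ X (proj₁ (∈-remove⁻ L w∈R)))
    M! : Unique M
    M! = All.tabulate (λ w∈R e≡w → e∉X (subst (_∈ X) (sym e≡w) (R⊆X w∈R))) ∷ remove-Unique L!
    |M|≡|X| : suc (length M) ≡ length X
    |M|≡|X| = trans (cong suc (length-remove L! b∈L)) (length-remove X! a∈X)
    p-q≤ : length (p -ₚ q) ≤ suc (length M)
    p-q≤ = length-+ₚ-·ₚ p (- 1ℤ) q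
      (subst (length p ≤_) (trans (length-remove X! a∈X) (sym |M|≡|X|)) p≤)
      (subst (length q ≤_) (trans (length-remove X! b∈X) (sym |M|≡|X|)) q≤)
    R-root : ∀ {w} → w ∈ R → eval (p -ₚ q) w ≡ 0ℤ
    R-root {w} w∈R with w∈L , w≢b ← ∈-remove⁻ L w∈R with w∈X , _ ← ∈-remove⁻ X w∈L =
      root--ₚ p q (All.lookup p≈f w∈L) (All.lookup q≈f (∈-remove⁺ w∈X w≢b))
    p-q≡hW : ∃[ h ] ∀ y → eval (p -ₚ q) y ≡ h * nodeProd M y
    p-q≡hW = factor-theorem M M! (p -ₚ q) p-q≤ (root--ₚ p q pe≡fe qe≡fe ∷ All.tabulate R-root)
    h C : ℤ
    h = proj₁ p-q≡hW
    C = nodeProd R a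
    pa-fa≡hW : eval p a - f a ≡ h * ((a - e) * C)
    pa-fa≡hW = begin
      eval p a - f a      ≡⟨ cong (_-_ (eval p a)) (All.lookup q≈f (∈-remove⁺ a∈X (b≢a ∘ sym))) ⟨
      eval p a - eval q a ≡⟨ eval--ₚ p q a ⟨
      eval (p -ₚ q) a     ≡⟨ proj₂ p-q≡hW a ⟩
      h * ((a - e) * C)   ∎
    regroup : ∀ h a b e C → h * ((a - e) * C) * (b - a) ≡ h * ((a - b) * C * (e - a))
    regroup = solve-∀

  exchange : ∀ S {a} → InConvClosure e S → All (λ s → s ∈ X × InterpInZ f (e ∷ remove s X)) S
           → a ∈ X → InterpInZ f (e ∷ remove a X) → InterpInZ f X
  exchange S {a} e∈⟨S⟩ S-interp a∈X Pa@(p , p≤ , _ ∷ p≈f) =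
    InterpInZ-⊇ f ⊆-∷-remove (ℕP.≤-reflexive (length-remove X! a∈X))
      (∣⇒InterpInZ-∷ f p p≤ p≈f a B∣fa-pa)
    where
    B δ : ℤ
    B = nodeProd (remove a X) a
    δ = eval p a - f a
    instance
      e-a≢0 : NonZero (e - a)
      e-a≢0 = ≢-nonZero (λ e-a≡0 → e∉X (subst (_∈ X) (sym (i-j≡0⇒i≡j e a e-a≡0)) a∈X))
    B[e-a]∣δ[S-a] : All (λ s → B * (e - a) U.∣ δ * (s - a)) S
    B[e-a]∣δ[S-a] = All.map (λ (s∈X , Ps) → ∣⇒∣ᵤ (exchange-∣ a∈X s∈X Pa Ps)) S-interp
    B∣δ : B U.∣ δ
    B∣δ = U.*-cancelʳ-∣ (e - a) {B} {δ} (InConvClosure-∣* e S e∈⟨S⟩ (B * (e - a)) δ a B[e-a]∣δ[S-a])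
    B∣fa-pa : B ∣ₛ f a - eval p a
    B∣fa-pa = ∣ᵤ⇒∣ (subst (∣ B ∣ ℕD.∣_) (∣i-j∣≡∣j-i∣ (eval p a) (f a)) B∣δ)

mainTheorem4 : (U : ℤ → Set) (f : ℤ → ℤ) (n : ℕ) (x : Fin n → ℤ)
    → Injective _≡_ _≡_ x
    → (∀ i → U (x i))
    → Circuit f (tabulate x)
    → (m : ℕ) → 2 ≤ m → (m≤n : m ≤ n)
    → (e : ℤ) → InConvClosure e (tabulate (λ (i : Fin m) → x (inject≤ i m≤n)))
    → U e → (∀ i → e ≢ x i)
    → Σ (Fin m) λ i → ¬ InterpInZ f (e ∷ remove (x (inject≤ i m≤n)) (tabulate x))
mainTheorem4 _ f n x x-inj _ (¬interp-X , interp-X-a) (suc m) (s≤s _) m≤n e e∈⟨S⟩ _ e≢x =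
  FinP.¬∀⟶∃¬ (suc m) _ interp? (¬interp-X ∘ all⇒interp-X)
  where
  X : List ℤ
  X = tabulate x
  X! : Unique X
  X! = Unique.tabulate⁺ x-inj
  e∉X : e ∉ X
  e∉X e∈X with i , refl ← ∈-tabulate⁻ e∈X = e≢x i refl
  S : Fin (suc m) → ℤ
  S i = x (inject≤ i m≤n)
  S∈X : ∀ i → S i ∈ X
  S∈X i = ∈-tabulate⁺ (inject≤ i m≤n)
  interp? : ∀ i → Dec (InterpInZ f (e ∷ remove (S i) X))
  interp? i with q , q≤ , q≈f ← interp-X-a (S∈X i) =
    InterpInZ-∷? f q (ℕP.m≤n⇒m≤1+n q≤) q≈f e (remove-Unique X!)
  all⇒interp-X : (∀ i → InterpInZ f (e ∷ remove (S i) X)) → InterpInZ f X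
  all⇒interp-X interp-all =
    exchange f X! e∉X (tabulate S) e∈⟨S⟩ (tabulate⁺ (λ i → S∈X i , interp-all i)) (S∈X Fin.zero) (interp-all Fin.zero)
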